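{- Let $G$ be a finite simple oriented graph with a fully traversable pebbling assignment $(S_G)$. Then $G\cong [S_G]$ (as directed graphs) if and only if $G$ is a downward directed rooted tree with root $r$ and $(S_G)$ places two or three pebbles on $r$, exactly one pebble on each non-root vertex of non-zero valence, and any number of pebbles on each vertex of valence zero.
   Context: An oriented graph is a directed graph with no loops, no multiple edges and no pair of opposite edges. The valence of a vertex is its out-degree. A pebbling assignment $(S_G)$ on $G$ assigns a nonnegative integer number of pebbles to each vertex. A pebbling move along an edge $(v,w)$ (allowed when $v$ has at least two pebbles) removes two pebbles from $v$ and adds one pebble to $w$. The assignment graph $[S_G]$ is the directed graph whose vertices are all assignments obtainable from $(S_G)$ by finite sequences of pebbling moves (including $(S_G)$ itself), with a directed edge from $A$ to $B$ whenever $B$ is obtained from $A$ by a single pebbling move. $(S_G)$ is fully traversable if $G$ has at least one edge and for every edge $(v,w)$ of $G$ some assignment reachable from $(S_G)$ admits a pebbling move along $(v,w)$. A downward directed rooted tree is an oriented graph whose underlying undirected graph is a tree, with a vertex $r$ (the root) such that every edge is directed away from $r$ (i.e. every vertex is reached from $r$ by a directed path). -}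

module Defs where

open import Data.Nat using (ℕ; _+_; _∸_; _≤_; _≥_)
open import Data.Fin using (Fin; _≟_)
open import Data.Bool using (Bool; true; false)
open import Data.List using (List; _∷_; length; _∷ʳ_)
open import Data.List.Relation.Unary.Linked using (Linked)
open import Data.List.Relation.Unary.Unique.Propositional using (Unique)
open import Data.Product using (Σ; ∃; ∃-syntax; _×_)
open import Data.Sum using (_⊎_)
open import Relation.Nullary using (¬_; yes; no)
open import Relation.Binary.PropositionalEquality using (_≡_)
open import Relation.Binary.Construct.Closure.ReflexiveTransitive using (Star)

Graph : ℕ → Set
Graph n = Fin n → Fin n → Bool

Edge : ∀ {n} → Graph n → Fin n → Fin n → Set
Edge E v w = E v w ≡ true

-- no loops and no pair of opposite edges (multiple edges impossible by construction)
Oriented : ∀ {n} → Graph n → Set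
Oriented {n} E = (∀ v → ¬ Edge E v v) × (∀ v w → Edge E v w → ¬ Edge E w v)

-- valence = out-degree; we only need "valence zero" vs "non-zero valence"
ValenceZero : ∀ {n} → Graph n → Fin n → Set
ValenceZero E v = ∀ w → ¬ Edge E v w

Assignment : ℕ → Set
Assignment n = Fin n → ℕ

moveAlong : ∀ {n} → Assignment n → Fin n → Fin n → Assignment n
moveAlong A v w u with u ≟ v
... | yes _ = A v ∸ 2
... | no _ with u ≟ w
...   | yes _ = A w + 1
...   | no _ = A u

Move : ∀ {n} → Graph n → Assignment n → Assignment n → Set
Move {n} E A B = Σ (Fin n) λ v → Σ (Fin n) λ w →
  Edge E v w × 2 ≤ A v × (∀ u → B u ≡ moveAlong A v w u)

Reachable : ∀ {n} → Graph n → Assignment n → Assignment n → Set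
Reachable E = Star (Move E)

FullyTraversable : ∀ {n} → Graph n → Assignment n → Set
FullyTraversable {n} E S =
  (Σ (Fin n) λ v → Σ (Fin n) λ w → Edge E v w) ×
  (∀ v w → Edge E v w → ∃[ A ] (Reachable E S A × 2 ≤ A v))

-- G ≅ [S_G] as directed graphs: a bijection f from the vertices of G onto the
-- vertices of [S_G] (the assignments reachable from S, compared pointwise)
-- such that (v , w) is an edge of G iff f w is obtained from f v by one move.
PointwiseEq : ∀ {n} → Assignment n → Assignment n → Set
PointwiseEq A B = ∀ u → A u ≡ B u

IsoToAssignmentGraph : ∀ {n} → Graph n → Assignment n → Set
IsoToAssignmentGraph {n} E S = Σ (Fin n → Assignment n) λ f →
  (∀ v → Reachable E S (f v)) ×
  (∀ v w → PointwiseEq (f v) (f w) → v ≡ w) ×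
  (∀ A → Reachable E S A → ∃[ v ] PointwiseEq (f v) A) ×
  (∀ v w → (Edge E v w → Move E (f v) (f w)) × (Move E (f v) (f w) → Edge E v w))

UEdge : ∀ {n} → Graph n → Fin n → Fin n → Set
UEdge E v w = Edge E v w ⊎ Edge E w v

UConnected : ∀ {n} → Graph n → Set
UConnected E = ∀ a b → Star (UEdge E) a b

HasUCycle : ∀ {n} → Graph n → Set
HasUCycle {n} E = Σ (Fin n) λ x → Σ (List (Fin n)) λ xs →
  length (x ∷ xs) ≥ 3 × Unique (x ∷ xs) × Linked (UEdge E) ((x ∷ xs) ∷ʳ x)

IsUTree : ∀ {n} → Graph n → Set
IsUTree E = UConnected E × ¬ HasUCycle E

DownwardRootedTree : ∀ {n} → Graph n → Fin n → Set
DownwardRootedTree E r = IsUTree E × (∀ v → Star (Edge E) r v)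

RootPebbling : ∀ {n} → Graph n → Fin n → Assignment n → Set
RootPebbling E r S =
  (S r ≡ 2 ⊎ S r ≡ 3) ×
  (∀ v → ¬ v ≡ r → ¬ ValenceZero E v → S v ≡ 1)

module Submission where

-- If f : G ≅ [S_G], every edge of G fires from some reachable assignment and G and [S_G] have
-- equally many edges, so each edge fires from exactly one reachable assignment.  Hence at most
-- one vertex is ever active, and it holds at most three pebbles.  Every move loses a pebble, so
-- [S_G] and G are acyclic; keeping track of which vertices have lost pebbles shows that two
-- moves into the same assignment start from the same one, so G has in-degree at most one.  The
-- vertex r with f r = S is then the root; it is the initially active vertex, so it holds 2 or 3
-- pebbles, and any other vertex with an out-edge can only fire after receiving a pebble, so it
-- holds exactly one.  Conversely, on such a tree the reachable assignments are exactly those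
-- obtained by pushing one pebble from r down to a vertex v, and v ↦ that assignment is an
-- isomorphism.

open import Defs
open import Level using (Level)
open import Data.Bool using (true; false)
open import Data.Nat using (ℕ; suc; _+_; _∸_; _≤_; _<_; z≤n; s≤s; z<s; _≤?_)
import Data.Nat as ℕ
open import Data.Nat.Properties
  using ( +-0-commutativeMonoid; +-comm; +-assoc; +-cancelʳ-≡; +-monoˡ-≤; m+[n∸m]≡n; m∸n+n≡m; m∸n≤m
        ; m≤m+n; m<m+n; m+n≮m; m+1+n≰m; 1+n≰n; ≤-refl; ≤-reflexive; ≤-trans; ≤-antisym; ≤-<-trans
        ; <-≤-trans; <-irrefl; n≮0; <⇒≢; ≰⇒>; ∸-monoˡ-≤; ∸-monoʳ-<; ≮⇒≥ )
open import Algebra.Properties.CommutativeMonoid.Sum +-0-commutativeMonoid using (sum; sum-remove; sum-cong-≗)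
open import Data.Fin using (Fin; _≟_; punchOut)
open import Data.Fin.Properties using (any?; punchInᵢ≢i; punchOut-injective; injective⇒≤; *↔×)
open import Data.Vec.Functional using (removeAt; updateAt)
open import Data.Vec.Functional.Properties using (updateAt-updates; updateAt-minimal)
open import Data.List using (List; []; _∷_; length; _∷ʳ_)
open import Data.List.Membership.Propositional using (_∈_)
open import Data.List.Relation.Binary.Subset.Propositional using (_⊆_)
open import Data.List.Relation.Unary.Any using (here; there)
open import Data.List.Relation.Unary.All using ([]; _∷_)
import Data.List.Relation.Unary.All as All
open import Data.List.Relation.Unary.All.Properties using (¬Any⇒All¬)
open import Data.List.Relation.Unary.AllPairs using ([]; _∷_)
open import Data.List.Relation.Unary.Linked using (Linked; [-]; _∷_)
import Data.List.Relation.Unary.Linked as Linked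
open import Data.List.Relation.Unary.Unique.Propositional using (Unique)
open import Data.Product using (Σ; ∃; ∃₂; _×_; _,_; proj₁; proj₂)
open import Data.Sum using (_⊎_; inj₁; inj₂)
open import Data.Unit using (⊤)
open import Data.Empty using (⊥; ⊥-elim)
open import Function.Bundles using (_↔_; Inverse; _⇔_; mk⇔)
open import Function.Definitions using (Injective)
open import Function.Properties.Inverse using (↔-sym)
open import Relation.Binary.Core using (Rel; _⇒_)
open import Relation.Binary.Definitions using (Sym; DecidableEquality)
open import Relation.Binary.Construct.Closure.ReflexiveTransitive
  using (Star; ε; _◅_; _◅◅_; map; gmap; revApp; reverse)
open import Relation.Binary.PropositionalEquality
  using (_≡_; _≢_; refl; sym; trans; cong; subst; ≢-sym; module ≡-Reasoning)
open import Relation.Nullary using (¬_; yes; no; contradiction)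
open import Relation.Nullary.Decidable using (decidable-stable; ¬¬-excluded-middle)

private
  variable
    a ℓ : Level
    V : Set a
    m n : ℕ

fin-injective⇒surjective : (h : Fin m → Fin m) → Injective _≡_ _≡_ h → ∀ y → ∃ λ x → h x ≡ y
fin-injective⇒surjective {suc m} h h-inj y with any? (λ x → h x ≟ y)
... | yes hit = hit
... | no miss = contradiction (injective⇒≤ punchOut∘h-injective) 1+n≰n
  where
  h≢y : ∀ x → y ≢ h x
  h≢y x y≡hx = miss (x , sym y≡hx)

  punchOut∘h-injective : Injective _≡_ _≡_ (λ x → punchOut (h≢y x))
  punchOut∘h-injective eq = h-inj (punchOut-injective (h≢y _) (h≢y _) eq)

fin-surjective⇒injective : (g : Fin m → Fin m) → (∀ y → ∃ λ x → g x ≡ y) → Injective _≡_ _≡_ g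
fin-surjective⇒injective {m} g g-surj = injective
  where
  section : Fin m → Fin m
  section y = proj₁ (g-surj y)

  g∘section : ∀ y → g (section y) ≡ y
  g∘section y = proj₂ (g-surj y)

  section-injective : Injective _≡_ _≡_ section
  section-injective {y} {y′} eq = trans (sym (g∘section y)) (trans (cong g eq) (g∘section y′))

  injective : Injective _≡_ _≡_ g
  injective {a} {b} ga≡gb
    with a′ , refl ← fin-injective⇒surjective section section-injective a
       | b′ , refl ← fin-injective⇒surjective section section-injective b
    = cong section (trans (sym (g∘section a′)) (trans ga≡gb (g∘section b′)))

surjective⇒injective : ∀ {X : Set a} → X ↔ Fin m → (g : X → X) → (∀ y → ∃ λ x → g x ≡ y) →
                       Injective _≡_ _≡_ g
surjective⇒injective {m = m} X↔Fin g g-surj {a} {b} ga≡gb =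
  trans (sym (strictlyInverseʳ a)) (trans (cong from (g′-injective to-a≡to-b)) (strictlyInverseʳ b))
  where
  open Inverse X↔Fin

  g′ : Fin m → Fin m
  g′ k = to (g (from k))

  g′-surjective : ∀ k → ∃ λ l → g′ l ≡ k
  g′-surjective k with x , gx≡ ← g-surj (from k) =
    to x , trans (cong (λ z → to (g z)) (strictlyInverseʳ x)) (trans (cong to gx≡) (strictlyInverseˡ k))

  g′-injective : Injective _≡_ _≡_ g′
  g′-injective = fin-surjective⇒injective g′ g′-surjective

  to-a≡to-b : g′ (to a) ≡ g′ (to b)
  to-a≡to-b = cong to (trans (cong g (strictlyInverseʳ a)) (trans ga≡gb (cong g (sym (strictlyInverseʳ b)))))

module _ {R : Rel V ℓ} where

  unsnoc : ∀ {x y} → Star R x y → x ≡ y ⊎ ∃ λ z → Star R x z × R z y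
  unsnoc ε = inj₁ refl
  unsnoc (e ◅ s) with unsnoc s
  ... | inj₁ refl          = inj₂ (_ , ε , e)
  ... | inj₂ (z , s′ , e′) = inj₂ (z , e ◅ s′ , e′)

  vertices : ∀ {x y} → Star R x y → List V
  vertices {x = x} ε       = x ∷ []
  vertices {x = x} (_ ◅ s) = x ∷ vertices s

  1≤length-vertices : ∀ {x y} (s : Star R x y) → 1 ≤ length (vertices s)
  1≤length-vertices ε       = s≤s z≤n
  1≤length-vertices (_ ◅ _) = s≤s z≤n

  start∈vertices : ∀ {x y} (s : Star R x y) → x ∈ vertices s
  start∈vertices ε       = here refl
  start∈vertices (_ ◅ _) = here refl

  ∈-vertices-◅◅ : ∀ {x y z} (s : Star R x y) (t : Star R y z) {v} →
                  v ∈ vertices (s ◅◅ t) → v ∈ vertices s ⊎ v ∈ vertices t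
  ∈-vertices-◅◅ ε       t v∈ = inj₂ v∈
  ∈-vertices-◅◅ (_ ◅ s) t (here refl) = inj₁ (here refl)
  ∈-vertices-◅◅ (_ ◅ s) t (there v∈) with ∈-vertices-◅◅ s t v∈
  ... | inj₁ v∈s = inj₁ (there v∈s)
  ... | inj₂ v∈t = inj₂ v∈t

  suffixFrom : ∀ {x y z} (s : Star R x y) → z ∈ vertices s →
               Σ (Star R z y) λ t → vertices t ⊆ vertices s × (Unique (vertices s) → Unique (vertices t))
  suffixFrom ε       (here refl) = ε , (λ v∈ → v∈) , (λ u → u)
  suffixFrom (e ◅ s) (here refl) = e ◅ s , (λ v∈ → v∈) , (λ u → u)
  suffixFrom (_ ◅ s) (there z∈) with t , t⊆s , unique ← suffixFrom s z∈ =
    t , (λ v∈ → there (t⊆s v∈)) , λ { (_ ∷ u) → unique u }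

  vertices-linked : ∀ {x y z} (s : Star R x y) → R y z → Linked R (vertices s ∷ʳ z)
  vertices-linked ε             r = r ∷ [-]
  vertices-linked (e ◅ ε)       r = e ∷ r ∷ [-]
  vertices-linked (e ◅ e′ ◅ s) r = e ∷ vertices-linked (e′ ◅ s) r

module _ {R : Rel V ℓ} {Q : Rel V ℓ} where

  vertices-map : (g : R ⇒ Q) → ∀ {x y} (s : Star R x y) → vertices (map g s) ≡ vertices s
  vertices-map g ε       = refl
  vertices-map g (_ ◅ s) rewrite vertices-map g s = refl

  ∈-vertices-revApp : (g : Sym R Q) → ∀ {x y z} (s : Star R y x) (t : Star Q y z) {v} →
                      v ∈ vertices (revApp g s t) → v ∈ vertices s ⊎ v ∈ vertices t
  ∈-vertices-revApp g ε       t v∈ = inj₂ v∈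
  ∈-vertices-revApp g (_ ◅ s) t v∈ with ∈-vertices-revApp g s (g _ ◅ t) v∈
  ... | inj₁ v∈s         = inj₁ (there v∈s)
  ... | inj₂ (here refl) = inj₁ (there (start∈vertices s))
  ... | inj₂ (there v∈t) = inj₂ v∈t

  ∈-vertices-reverse : (g : Sym R Q) → ∀ {x y} (s : Star R x y) → vertices (reverse g s) ⊆ vertices s
  ∈-vertices-reverse g s v∈ with ∈-vertices-revApp g s ε v∈
  ... | inj₁ v∈s         = v∈s
  ... | inj₂ (here refl) = start∈vertices s

module _ (_≟_ : DecidableEquality V) {R : Rel V ℓ} where

  open import Data.List.Membership.DecPropositional _≟_ using (_∈?_)

  loopErase : ∀ {x y} (s : Star R x y) → Σ (Star R x y) λ t → Unique (vertices t) × vertices t ⊆ vertices s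
  loopErase ε = ε , [] ∷ [] , λ v∈ → v∈
  loopErase {x = x} (e ◅ s) with t , unique , t⊆s ← loopErase s | x ∈? vertices t
  ... | yes x∈t = let u , u⊆t , unique-u = suffixFrom t x∈t in
                  u , unique-u unique , λ v∈ → there (t⊆s (u⊆t v∈))
  ... | no x∉t  = e ◅ t , ¬Any⇒All¬ (vertices t) x∉t ∷ unique ,
                  λ { (here refl) → here refl ; (there v∈) → there (t⊆s v∈) }

module _ {V : Set} where

  lastOf : V → List V → V
  lastOf x []       = x
  lastOf _ (y ∷ ys) = lastOf y ys

  penultimateOf : V → V → List V → V
  penultimateOf x _ []       = x
  penultimateOf _ y (z ∷ zs) = penultimateOf y z zs

  NonBacktracking : List V → Set
  NonBacktracking (x ∷ y ∷ z ∷ zs) = x ≢ z × NonBacktracking (y ∷ z ∷ zs)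
  NonBacktracking _                = ⊤

  lastOf-∷ʳ : ∀ x ys z → lastOf x (ys ∷ʳ z) ≡ z
  lastOf-∷ʳ x []       z = refl
  lastOf-∷ʳ x (y ∷ ys) z = lastOf-∷ʳ y ys z

  penultimateOf-∷ʳ : ∀ x y zs w → penultimateOf x y (zs ∷ʳ w) ≡ lastOf y zs
  penultimateOf-∷ʳ x y []       w = refl
  penultimateOf-∷ʳ x y (z ∷ zs) w = penultimateOf-∷ʳ y z zs w

  lastOf∈ : ∀ x ys → lastOf x ys ∈ x ∷ ys
  lastOf∈ x []       = here refl
  lastOf∈ x (y ∷ ys) = there (lastOf∈ y ys)

  penultimateOf∈ : ∀ x y zs → penultimateOf x y zs ∈ x ∷ y ∷ zs
  penultimateOf∈ x y []       = here refl
  penultimateOf∈ x y (z ∷ zs) = there (penultimateOf∈ y z zs)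

  unique⇒nonBacktracking-∷ʳ : ∀ x y zs w → Unique (x ∷ y ∷ zs) → penultimateOf x y zs ≢ w →
                               NonBacktracking ((x ∷ y ∷ zs) ∷ʳ w)
  unique⇒nonBacktracking-∷ʳ x y []       w _                   p≢w = p≢w , _
  unique⇒nonBacktracking-∷ʳ x y (z ∷ zs) w ((_ ∷ x≢z ∷ _) ∷ u) p≢w =
    x≢z , unique⇒nonBacktracking-∷ʳ y z zs w u p≢w

module _ {n : ℕ} (E : Graph n) where

  open import Data.List.Membership.DecPropositional (_≟_ {n}) using (_∈?_)

  Ancestor : Fin n → Fin n → Set
  Ancestor = Star (Edge E)

  Acyclic : Set
  Acyclic = ∀ {x y} → Edge E x y → ¬ Ancestor y x

  InDegree≤1 : Set
  InDegree≤1 = ∀ {a b c} → Edge E a c → Edge E b c → a ≡ b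

  Rooted : Fin n → Set
  Rooted r = ∀ v → Ancestor r v

  acyclic⇒irreflexive : Acyclic → ∀ {x y} → Edge E x y → x ≢ y
  acyclic⇒irreflexive acyclic exy refl = acyclic exy ε

  acyclic⇒ancestor-antisym : Acyclic → ∀ {x y} → Ancestor x y → Ancestor y x → x ≡ y
  acyclic⇒ancestor-antisym acyclic x⋯y y⋯x with unsnoc x⋯y
  ... | inj₁ x≡y             = x≡y
  ... | inj₂ (_ , x⋯p , epy) = ⊥-elim (acyclic epy (y⋯x ◅◅ x⋯p))

  Path⁺ : Fin n → Fin n → Set
  Path⁺ x z = ∃ λ y → Edge E x y × Ancestor y z

  rooted⇒connected : ∀ {r} → Rooted r → UConnected E
  rooted⇒connected rooted a b = reverse inj₂ (rooted a) ◅◅ map inj₁ (rooted b)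

  noUCycle⇒acyclic : Oriented E → ¬ HasUCycle E → Acyclic
  noUCycle⇒acyclic (irreflexive , asymmetric) noCycle {x} {y} exy yx with loopErase _≟_ yx
  ... | ε          , _      , _ = irreflexive x exy
  ... | e ◅ ε      , _      , _ = asymmetric x y exy e
  ... | e ◅ e′ ◅ t , unique , _ =
    noCycle (y , vertices (e′ ◅ t) , s≤s (s≤s (1≤length-vertices t)) , unique ,
             Linked.map inj₁ (vertices-linked (e ◅ e′ ◅ t) exy))

  -- Two parents a ≢ b of c close the undirected walk a ⋯ r ⋯ b into a cycle through c,
  -- unless c already lies on it, which would make c an ancestor of a or of b.
  rooted∧noUCycle⇒inDegree≤1 : Oriented E → ¬ HasUCycle E → ∀ {r} → Rooted r → InDegree≤1
  rooted∧noUCycle⇒inDegree≤1 oriented noCycle {r} rooted {a} {b} {c} eac ebc =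
    decidable-stable (a ≟ b) λ a≢b → noSimplePath a≢b (loopErase _≟_ walk)
    where
    acyclic : Acyclic
    acyclic = noUCycle⇒acyclic oriented noCycle

    up : Star (UEdge E) a r
    up = reverse inj₂ (rooted a)

    down : Star (UEdge E) r b
    down = map inj₁ (rooted b)

    walk : Star (UEdge E) a b
    walk = up ◅◅ down

    c∉walk : ¬ c ∈ vertices walk
    c∉walk c∈ with ∈-vertices-◅◅ up down c∈
    ... | inj₁ c∈up   = acyclic eac (proj₁ (suffixFrom (rooted a) (∈-vertices-reverse inj₂ (rooted a) c∈up)))
    ... | inj₂ c∈down =
      acyclic ebc (proj₁ (suffixFrom (rooted b) (subst (c ∈_) (vertices-map inj₁ (rooted b)) c∈down)))

    noSimplePath : a ≢ b → ¬ (Σ (Star (UEdge E) a b) λ t → Unique (vertices t) × vertices t ⊆ vertices walk)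
    noSimplePath a≢b (ε , _) = a≢b refl
    noSimplePath _ (e ◅ t , unique , t⊆walk) with c ∈? vertices (e ◅ t)
    ... | yes c∈ = c∉walk (t⊆walk c∈)
    ... | no c∉  = noCycle (c , vertices (e ◅ t) , s≤s (s≤s (1≤length-vertices t)) ,
                            ¬Any⇒All¬ _ c∉ ∷ unique , inj₂ eac ∷ vertices-linked (e ◅ t) (inj₁ ebc))

  module _ (inDegree≤1 : InDegree≤1) where

    -- A forward step x → y cannot be followed by a backward step y ← z, as x ≢ z would both be
    -- parents of y; so a non-backtracking walk goes backward for a while, then forward.
    forward-nonBacktracking : ∀ x y zs → Edge E x y → Linked (UEdge E) (x ∷ y ∷ zs) →
                              NonBacktracking (x ∷ y ∷ zs) →
                              Path⁺ x (lastOf y zs) × Edge E (penultimateOf x y zs) (lastOf y zs)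
    forward-nonBacktracking x y []       exy _ _ = (y , exy , ε) , exy
    forward-nonBacktracking x y (z ∷ zs) exy (_ ∷ inj₁ eyz ∷ linked) (x≢z , nb)
      with (w , eyw , w⋯) , last ← forward-nonBacktracking y z zs eyz (inj₁ eyz ∷ linked) nb =
      (y , exy , eyw ◅ w⋯) , last
    forward-nonBacktracking x y (z ∷ zs) exy (_ ∷ inj₂ ezy ∷ _) (x≢z , _) =
      ⊥-elim (x≢z (inDegree≤1 exy ezy))

    nonBacktracking-trichotomy :
      ∀ x y zs → Linked (UEdge E) (x ∷ y ∷ zs) → NonBacktracking (x ∷ y ∷ zs) →
      (Path⁺ x (lastOf y zs) × Edge E (penultimateOf x y zs) (lastOf y zs)) ⊎
      Path⁺ (lastOf y zs) x ⊎
      (Edge E y x × Edge E (penultimateOf x y zs) (lastOf y zs))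
    nonBacktracking-trichotomy x y zs (inj₁ exy ∷ linked) nb =
      inj₁ (forward-nonBacktracking x y zs exy (inj₁ exy ∷ linked) nb)
    nonBacktracking-trichotomy x y [] (inj₂ eyx ∷ _) _ = inj₂ (inj₁ (x , eyx , ε))
    nonBacktracking-trichotomy x y (z ∷ zs) (inj₂ eyx ∷ linked) (_ , nb)
      with nonBacktracking-trichotomy y z zs linked nb
    ... | inj₁ (_ , last)              = inj₂ (inj₂ (eyx , last))
    ... | inj₂ (inj₁ (w , ew , w⋯y))   = inj₂ (inj₁ (w , ew , w⋯y ◅◅ eyx ◅ ε))
    ... | inj₂ (inj₂ (_ , last))       = inj₂ (inj₂ (eyx , last))

  acyclic∧inDegree≤1⇒noUCycle : Acyclic → InDegree≤1 → ¬ HasUCycle E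
  acyclic∧inDegree≤1⇒noUCycle acyclic inDegree≤1 (x , []    , s≤s () , _)
  acyclic∧inDegree≤1⇒noUCycle acyclic inDegree≤1 (x , _ ∷ [] , s≤s (s≤s ()) , _)
  acyclic∧inDegree≤1⇒noUCycle acyclic inDegree≤1
    (x , y ∷ z ∷ zs , _ , unique@(x∉ ∷ y∉ ∷ _) , linked)
    with nonBacktracking-trichotomy inDegree≤1 x y ((z ∷ zs) ∷ʳ x) linked nonBacktracking
    where
    nonBacktracking : NonBacktracking ((x ∷ y ∷ z ∷ zs) ∷ʳ x)
    nonBacktracking = unique⇒nonBacktracking-∷ʳ x y (z ∷ zs) x unique
                        (λ p≡x → All.lookup x∉ (penultimateOf∈ y z zs) (sym p≡x))
  ... | inj₁ ((w , ew , w⋯x) , _) rewrite lastOf-∷ʳ y (z ∷ zs) x = acyclic ew w⋯x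
  ... | inj₂ (inj₁ (w , ew , w⋯x)) rewrite lastOf-∷ʳ y (z ∷ zs) x = acyclic ew w⋯x
  ... | inj₂ (inj₂ (eyx , epx))
    rewrite lastOf-∷ʳ y (z ∷ zs) x | penultimateOf-∷ʳ x y (z ∷ zs) x =
    All.lookup y∉ (lastOf∈ z zs) (inDegree≤1 eyx epx)

2or3⇒2≤ : ∀ {k} → k ≡ 2 ⊎ k ≡ 3 → 2 ≤ k
2or3⇒2≤ (inj₁ refl) = s≤s (s≤s z≤n)
2or3⇒2≤ (inj₂ refl) = s≤s (s≤s z≤n)

2or3⇒≤3 : ∀ {k} → k ≡ 2 ⊎ k ≡ 3 → k ≤ 3
2or3⇒≤3 (inj₁ refl) = s≤s (s≤s z≤n)
2or3⇒≤3 (inj₂ refl) = ≤-refl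

≤3⇒2≰∸2 : ∀ {k} → k ≤ 3 → ¬ 2 ≤ k ∸ 2
≤3⇒2≰∸2 z≤n                   ()
≤3⇒2≰∸2 (s≤s z≤n)             ()
≤3⇒2≰∸2 (s≤s (s≤s z≤n))       ()
≤3⇒2≰∸2 (s≤s (s≤s (s≤s z≤n))) (s≤s ())

2≤+1⇒1≤ : ∀ {k} → 2 ≤ k + 1 → 1 ≤ k
2≤+1⇒1≤ {suc _} _       = s≤s z≤n
2≤+1⇒1≤ {0}     (s≤s ())

2≤∧≤3⇒2or3 : ∀ {k} → 2 ≤ k → k ≤ 3 → k ≡ 2 ⊎ k ≡ 3
2≤∧≤3⇒2or3 (s≤s (s≤s z≤n)) (s≤s (s≤s z≤n))       = inj₁ refl
2≤∧≤3⇒2or3 (s≤s (s≤s z≤n)) (s≤s (s≤s (s≤s z≤n))) = inj₂ refl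

module _ (A : Assignment n) where

  moveAlong-source : ∀ v w → moveAlong A v w v ≡ A v ∸ 2
  moveAlong-source v w with v ≟ v
  ... | yes _   = refl
  ... | no v≢v = ⊥-elim (v≢v refl)

  moveAlong-target : ∀ {v w} → v ≢ w → moveAlong A v w w ≡ A w + 1
  moveAlong-target {v} {w} v≢w with w ≟ v
  ... | yes w≡v = ⊥-elim (v≢w (sym w≡v))
  ... | no _ with w ≟ w
  ...   | yes _   = refl
  ...   | no w≢w = ⊥-elim (w≢w refl)

  moveAlong-other : ∀ {v w u} → u ≢ v → u ≢ w → moveAlong A v w u ≡ A u
  moveAlong-other {v} {w} {u} u≢v u≢w with u ≟ v
  ... | yes u≡v = ⊥-elim (u≢v u≡v)
  ... | no _ with u ≟ w
  ...   | yes u≡w = ⊥-elim (u≢w u≡w)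
  ...   | no _    = refl

  moveAlong-≥ : ∀ {v w u} → u ≢ v → A u ≤ moveAlong A v w u
  moveAlong-≥ {v} {w} {u} u≢v with w ≟ u
  ... | yes refl = subst (A w ≤_) (sym (moveAlong-target (≢-sym u≢v))) (m≤m+n (A w) 1)
  ... | no w≢u   = subst (A u ≤_) (sym (moveAlong-other u≢v (≢-sym w≢u))) ≤-refl

moveAlong-changes : ∀ (A : Assignment n) {v w} → 2 ≤ A v → ¬ PointwiseEq A (moveAlong A v w)
moveAlong-changes A {v} {w} 2≤Av A≗ = <⇒≢ (∸-monoʳ-< z<s 2≤Av) (sym (trans (A≗ v) (moveAlong-source A v w)))

moveAlong-cong : ∀ {A A′ : Assignment n} → PointwiseEq A A′ →
                 ∀ v w → PointwiseEq (moveAlong A v w) (moveAlong A′ v w)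
moveAlong-cong A≗A′ v w u with u ≟ v
... | yes _ = cong (_∸ 2) (A≗A′ v)
... | no _ with u ≟ w
...   | yes _ = cong (_+ 1) (A≗A′ w)
...   | no _  = A≗A′ u

-- The source is the only vertex that loses pebbles.
moveAlong-injective : ∀ (A : Assignment n) {v w a b} → v ≢ w → a ≢ b → 2 ≤ A v →
                      PointwiseEq (moveAlong A v w) (moveAlong A a b) → v ≡ a × w ≡ b
moveAlong-injective A {v} {w} {a} {b} v≢w a≢b 2≤Av same = v≡a , w≡b
  where
  v≡a : v ≡ a
  v≡a with v ≟ a | v ≟ b
  ... | yes v≡a | _       = v≡a
  ... | no v≢a | yes refl =
    ⊥-elim (<⇒≢ (≤-<-trans (m∸n≤m (A v) 2) (m<m+n (A v) z<s))
                (trans (sym (moveAlong-source A v w)) (trans (same v) (moveAlong-target A a≢b))))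
  ... | no v≢a | no v≢b   =
    ⊥-elim (<⇒≢ (∸-monoʳ-< z<s 2≤Av)
                (trans (sym (moveAlong-source A v w)) (trans (same v) (moveAlong-other A v≢a v≢b))))

  w≡b : w ≡ b
  w≡b with w ≟ b
  ... | yes w≡b = w≡b
  ... | no w≢b  =
    ⊥-elim (<⇒≢ (m<m+n (A w) z<s)
                (sym (trans (sym (moveAlong-target A v≢w))
                            (trans (same w) (moveAlong-other A (λ w≡a → v≢w (trans v≡a (sym w≡a))) w≢b)))))

pebbles : Assignment n → ℕ
pebbles = sum

pebbles-update : ∀ {A B : Assignment n} v → (∀ u → u ≢ v → B u ≡ A u) → pebbles B + A v ≡ pebbles A + B v
pebbles-update {n = suc _} {A = A} {B} v agree = begin
  sum B + A v                         ≡⟨ cong (_+ A v) (sum-remove {i = v} B) ⟩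
  B v + sum (removeAt B v) + A v      ≡⟨ cong (λ r → B v + r + A v) (sum-cong-≗ λ j → agree _ (punchInᵢ≢i v j)) ⟩
  B v + rest + A v                    ≡⟨ +-comm (B v + rest) (A v) ⟩
  A v + (B v + rest)                  ≡⟨ cong (A v +_) (+-comm (B v) rest) ⟩
  A v + (rest + B v)                  ≡⟨ +-assoc (A v) rest (B v) ⟨
  A v + rest + B v                    ≡⟨ cong (_+ B v) (sum-remove {i = v} A) ⟨
  sum A + B v                         ∎
  where
  open ≡-Reasoning

  rest : ℕ
  rest = sum (removeAt A v)

-- Through the intermediate assignment C in which v has lost its two pebbles but w gained nothing.
pebbles-moveAlong : ∀ (A : Assignment n) {v w} → v ≢ w → 2 ≤ A v → pebbles (moveAlong A v w) + 1 ≡ pebbles A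
pebbles-moveAlong A {v} {w} v≢w 2≤Av = begin
  pebbles M + 1      ≡⟨ cong (_+ 1) (+-cancelʳ-≡ (A w) _ _ added) ⟩
  pebbles C + 1 + 1  ≡⟨ +-assoc (pebbles C) 1 1 ⟩
  pebbles C + 2      ≡⟨ +-cancelʳ-≡ (A v ∸ 2) _ _ removed ⟩
  pebbles A          ∎
  where
  open ≡-Reasoning
  C : Assignment _
  C = updateAt A v (_∸ 2)

  M : Assignment _
  M = moveAlong A v w

  C-elsewhere : ∀ u → u ≢ v → C u ≡ A u
  C-elsewhere u u≢v = updateAt-minimal u v A u≢v

  removed : pebbles C + 2 + (A v ∸ 2) ≡ pebbles A + (A v ∸ 2)
  removed = begin
    pebbles C + 2 + (A v ∸ 2)   ≡⟨ +-assoc (pebbles C) 2 _ ⟩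
    pebbles C + (2 + (A v ∸ 2)) ≡⟨ cong (pebbles C +_) (m+[n∸m]≡n 2≤Av) ⟩
    pebbles C + A v             ≡⟨ pebbles-update v C-elsewhere ⟩
    pebbles A + C v             ≡⟨ cong (pebbles A +_) (updateAt-updates v A) ⟩
    pebbles A + (A v ∸ 2)       ∎

  M-off-w : ∀ u → u ≢ w → M u ≡ C u
  M-off-w u u≢w with v ≟ u
  ... | yes refl = trans (moveAlong-source A v w) (sym (updateAt-updates v A))
  ... | no v≢u   = trans (moveAlong-other A (≢-sym v≢u) u≢w) (sym (C-elsewhere u (≢-sym v≢u)))

  added : pebbles M + A w ≡ pebbles C + 1 + A w
  added = begin
    pebbles M + A w        ≡⟨ cong (pebbles M +_) (C-elsewhere w (≢-sym v≢w)) ⟨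
    pebbles M + C w        ≡⟨ pebbles-update w M-off-w ⟩
    pebbles C + M w        ≡⟨ cong (pebbles C +_) (trans (moveAlong-target A v≢w) (+-comm (A w) 1)) ⟩
    pebbles C + (1 + A w)  ≡⟨ +-assoc (pebbles C) 1 (A w) ⟨
    pebbles C + 1 + A w    ∎

module _ {E : Graph n} where

  Move-respʳ : ∀ {A B B′} → Move E A B → PointwiseEq B B′ → Move E A B′
  Move-respʳ (v , w , e , 2≤Av , B≗) B≗B′ = v , w , e , 2≤Av , λ u → trans (sym (B≗B′ u)) (B≗ u)

  Move-respˡ : ∀ {A A′ B} → Move E A B → PointwiseEq A A′ → Move E A′ B
  Move-respˡ (v , w , e , 2≤Av , B≗) A≗A′ =
    v , w , e , subst (2 ≤_) (A≗A′ v) 2≤Av , λ u → trans (B≗ u) (moveAlong-cong A≗A′ v w u)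

  moveAlong-Move : ∀ {A v w} → Edge E v w → 2 ≤ A v → Move E A (moveAlong A v w)
  moveAlong-Move {v = v} {w} e 2≤Av = v , w , e , 2≤Av , λ _ → refl

  module _ (irreflexive : ∀ v → ¬ Edge E v v) where

    pebbles-Move : ∀ {A B} → Move E A B → pebbles B + 1 ≡ pebbles A
    pebbles-Move {A} (v , w , e , 2≤Av , B≗) =
      trans (cong (_+ 1) (sum-cong-≗ B≗)) (pebbles-moveAlong A (λ { refl → irreflexive v e }) 2≤Av)

    pebbles-Reachable : ∀ {A B} → Reachable E A B → pebbles B ≤ pebbles A
    pebbles-Reachable ε = ≤-refl
    pebbles-Reachable (m ◅ rest) =
      ≤-trans (pebbles-Reachable rest) (subst (_ ≤_) (pebbles-Move m) (m≤m+n _ 1))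

    Move⇒¬Reachable-back : ∀ {A B} → Move E A B → ¬ Reachable E B A
    Move⇒¬Reachable-back m back =
      1+n≰n (subst (_≤ _) (trans (sym (pebbles-Move m)) (+-comm _ 1)) (pebbles-Reachable back))

module FromTreePebbling {n} {E : Graph n} (S : Assignment n) {r : Fin n}
  (rooted : Rooted E r) (acyclic : Acyclic E) (inDegree≤1 : InDegree≤1 E)
  (root-pebbles : S r ≡ 2 ⊎ S r ≡ 3) (one-pebble : ∀ v → v ≢ r → ¬ ValenceZero E v → S v ≡ 1) where

  edge⇒≢ : ∀ {x y} → Edge E x y → x ≢ y
  edge⇒≢ = acyclic⇒irreflexive E acyclic

  root-parentless : ∀ {p} → ¬ Edge E p r
  root-parentless e = acyclic e (rooted _)

  edge⇒target≢root : ∀ {x y} → Edge E x y → y ≢ r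
  edge⇒target≢root e refl = root-parentless e

  ancestor-of-root : ∀ {u} → Ancestor E u r → u ≡ r
  ancestor-of-root u⋯r with unsnoc u⋯r
  ... | inj₁ u≡r          = u≡r
  ... | inj₂ (_ , _ , e) = ⊥-elim (root-parentless e)

  ancestor-of-child : ∀ {u v w} → Ancestor E u w → Edge E v w → u ≡ w ⊎ Ancestor E u v
  ancestor-of-child u⋯w evw with unsnoc u⋯w
  ... | inj₁ u≡w = inj₁ u≡w
  ... | inj₂ (p , u⋯p , epw) with refl ← inDegree≤1 epw evw = inj₂ u⋯p

  inner-one : ∀ {v w} → v ≢ r → Edge E v w → S v ≡ 1
  inner-one v≢r e = one-pebble _ v≢r (λ noEdges → noEdges _ e)

  2≤root : 2 ≤ S r
  2≤root = 2or3⇒2≤ root-pebbles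

  root≤3 : S r ≤ 3
  root≤3 = 2or3⇒≤3 root-pebbles

  -- The assignment obtained by pushing one pebble from r down the tree path to v ≢ r:
  -- r pays two pebbles, each inner vertex of the path passes its single pebble on.
  record PushedBelowRoot (v : Fin n) (A : Assignment n) : Set where
    field
      at-target : A v ≡ S v + 1
      at-root   : A r ≡ S r ∸ 2
      on-path   : ∀ u → u ≢ r → u ≢ v → Ancestor E u v → A u ≡ S u ∸ 1
      off-path  : ∀ u → ¬ Ancestor E u v → A u ≡ S u
  open PushedBelowRoot

  PushedTo : Fin n → Assignment n → Set
  PushedTo v A = (v ≡ r × PointwiseEq A S) ⊎ (v ≢ r × PushedBelowRoot v A)

  push-from-root : ∀ {A y} → PointwiseEq A S → Edge E r y → PushedBelowRoot y (moveAlong A r y)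
  push-from-root {A} {y} A≗S e = record
    { at-target = trans (moveAlong-target A (edge⇒≢ e)) (cong (_+ 1) (A≗S y))
    ; at-root   = trans (moveAlong-source A r y) (cong (_∸ 2) (A≗S r))
    ; on-path   = on-path′
    ; off-path  = λ u u⋯̸y →
        trans (moveAlong-other A (λ { refl → u⋯̸y (rooted y) }) (λ { refl → u⋯̸y ε })) (A≗S u)
    }
    where
    on-path′ : ∀ u → u ≢ r → u ≢ y → Ancestor E u y → moveAlong A r y u ≡ S u ∸ 1
    on-path′ u u≢r u≢y u⋯y with ancestor-of-child u⋯y e
    ... | inj₁ u≡y = ⊥-elim (u≢y u≡y)
    ... | inj₂ u⋯r = ⊥-elim (u≢r (ancestor-of-root u⋯r))

  push-below-root : ∀ {A x y} → x ≢ r → PushedBelowRoot x A → Edge E x y →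
                    PushedBelowRoot y (moveAlong A x y)
  push-below-root {A} {x} {y} x≢r pushed e = record
    { at-target = trans (moveAlong-target A (edge⇒≢ e)) (cong (_+ 1) (off-path pushed y (acyclic e)))
    ; at-root   = trans (moveAlong-other A (≢-sym x≢r) (≢-sym (edge⇒target≢root e)))
                        (at-root pushed)
    ; on-path   = on-path′
    ; off-path  = off-path′
    }
    where
    on-path′ : ∀ u → u ≢ r → u ≢ y → Ancestor E u y → moveAlong A x y u ≡ S u ∸ 1
    on-path′ u u≢r u≢y u⋯y with x ≟ u
    ... | yes refl = trans (moveAlong-source A x y) (cong (_∸ 2) (trans (at-target pushed) (+-comm (S x) 1)))
    ... | no x≢u with ancestor-of-child u⋯y e
    ...   | inj₁ u≡y = ⊥-elim (u≢y u≡y)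
    ...   | inj₂ u⋯x = trans (moveAlong-other A (≢-sym x≢u) u≢y) (on-path pushed u u≢r (≢-sym x≢u) u⋯x)

    off-path′ : ∀ u → ¬ Ancestor E u y → moveAlong A x y u ≡ S u
    off-path′ u u⋯̸y = trans (moveAlong-other A (λ { refl → u⋯̸y (e ◅ ε) }) (λ { refl → u⋯̸y ε }))
                            (off-path pushed u (λ u⋯x → u⋯̸y (u⋯x ◅◅ e ◅ ε)))

  push : ∀ {A x y} → PushedTo x A → Edge E x y → 2 ≤ A x × PushedTo y (moveAlong A x y)
  push (inj₁ (refl , A≗S)) e =
    subst (2 ≤_) (sym (A≗S r)) 2≤root , inj₂ (edge⇒target≢root e , push-from-root A≗S e)
  push {x = x} (inj₂ (x≢r , pushed)) e =
    subst (2 ≤_) (sym (trans (at-target pushed) (cong (_+ 1) (inner-one x≢r e)))) ≤-refl ,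
    inj₂ (edge⇒target≢root e , push-below-root x≢r pushed e)

  push-along : ∀ {x v A} → Ancestor E x v → PushedTo x A → Reachable E S A →
               Σ (Assignment n) λ B → PushedTo v B × Reachable E S B
  push-along ε          pushedA reach = _ , pushedA , reach
  push-along (e ◅ path) pushedA reach with 2≤ , pushed′ ← push pushedA e =
    push-along path pushed′ (reach ◅◅ moveAlong-Move e 2≤ ◅ ε)

  pushedAssignment : ∀ v → Σ (Assignment n) λ A → PushedTo v A × Reachable E S A
  pushedAssignment v = push-along (rooted v) (inj₁ (refl , λ _ → refl)) ε

  -- Ancestry is not decided here, but the goals below are decidable, so we may still split on it.
  pushedTo-unique : ∀ {w A B} → PushedTo w A → PushedTo w B → PointwiseEq A B
  pushedTo-unique (inj₁ (_ , A≗S))   (inj₁ (_ , B≗S))   u = trans (A≗S u) (sym (B≗S u))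
  pushedTo-unique (inj₁ (w≡r , _))   (inj₂ (w≢r , _))   = ⊥-elim (w≢r w≡r)
  pushedTo-unique (inj₂ (w≢r , _))   (inj₁ (w≡r , _))   = ⊥-elim (w≢r w≡r)
  pushedTo-unique {w} (inj₂ (_ , pA)) (inj₂ (_ , pB)) u with u ≟ w | u ≟ r
  ... | yes refl | _        = trans (at-target pA) (sym (at-target pB))
  ... | no _     | yes refl = trans (at-root pA) (sym (at-root pB))
  ... | no u≢w   | no u≢r   = decidable-stable (_ ℕ.≟ _) λ A≢B → ¬¬-excluded-middle λ
    { (yes u⋯w) → A≢B (trans (on-path pA u u≢r u≢w u⋯w) (sym (on-path pB u u≢r u≢w u⋯w)))
    ; (no u⋯̸w)  → A≢B (trans (off-path pA u u⋯̸w) (sym (off-path pB u u⋯̸w)))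
    }

  pushedTo-active : ∀ {v A a b} → PushedTo v A → Edge E a b → 2 ≤ A a → a ≡ v
  pushedTo-active {a = a} (inj₁ (refl , A≗S)) e 2≤Aa with a ≟ r
  ... | yes a≡r = a≡r
  ... | no a≢r  = ⊥-elim (1+n≰n (subst (2 ≤_) (trans (A≗S a) (inner-one a≢r e)) 2≤Aa))
  pushedTo-active {v} {a = a} (inj₂ (v≢r , pA)) e 2≤Aa with a ≟ r
  ... | yes refl = ⊥-elim (≤3⇒2≰∸2 root≤3 (subst (2 ≤_) (at-root pA) 2≤Aa))
  ... | no a≢r   = decidable-stable (a ≟ v) λ a≢v → ¬¬-excluded-middle λ
    { (yes a⋯v) → n≮0 (subst (2 ≤_) (trans (on-path pA a a≢r a≢v a⋯v) (cong (_∸ 1) (inner-one a≢r e))) 2≤Aa)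
    ; (no a⋯̸v)  → 1+n≰n (subst (2 ≤_) (trans (off-path pA a a⋯̸v) (inner-one a≢r e)) 2≤Aa)
    }

  root≢belowRoot : ∀ {w A B} → PointwiseEq A S → PushedBelowRoot w B → ¬ PointwiseEq A B
  root≢belowRoot {A = A} A≗S pB A≗B =
    <⇒≢ (∸-monoʳ-< z<s 2≤root) (trans (sym (at-root pB)) (trans (sym (A≗B r)) (A≗S r)))

  pushedTo-injective : ∀ {v w A B} → PushedTo v A → PushedTo w B → PointwiseEq A B → v ≡ w
  pushedTo-injective (inj₁ (refl , _))   (inj₁ (refl , _))   _   = refl
  pushedTo-injective (inj₁ (_ , A≗S))    (inj₂ (_ , pB))     A≗B = ⊥-elim (root≢belowRoot A≗S pB A≗B)
  pushedTo-injective (inj₂ (_ , pA))     (inj₁ (_ , B≗S))    A≗B = ⊥-elim (root≢belowRoot B≗S pA (λ u → sym (A≗B u)))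
  pushedTo-injective {v} {w} (inj₂ (v≢r , pA)) (inj₂ (_ , pB)) A≗B =
    decidable-stable (v ≟ w) λ v≢w → ¬¬-excluded-middle λ
    { (yes v⋯w) → <⇒≢ (≤-<-trans (m∸n≤m (S v) 1) (m<m+n (S v) z<s))
                      (trans (sym (on-path pB v v≢r v≢w v⋯w)) (trans (sym (A≗B v)) (at-target pA)))
    ; (no v⋯̸w)  → <⇒≢ (m<m+n (S v) z<s) (trans (sym (off-path pB v v⋯̸w)) (trans (sym (A≗B v)) (at-target pA)))
    }

  assignmentAt : Fin n → Assignment n
  assignmentAt v = proj₁ (pushedAssignment v)

  pushedTo-assignmentAt : ∀ v → PushedTo v (assignmentAt v)
  pushedTo-assignmentAt v = proj₁ (proj₂ (pushedAssignment v))

  assignmentAt-edge : ∀ {v w} → Edge E v w →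
                      2 ≤ assignmentAt v v × PointwiseEq (assignmentAt w) (moveAlong (assignmentAt v) v w)
  assignmentAt-edge {v} {w} e with 2≤ , pushed′ ← push (pushedTo-assignmentAt v) e =
    2≤ , pushedTo-unique (pushedTo-assignmentAt w) pushed′

  edge⇒move : ∀ {v w} → Edge E v w → Move E (assignmentAt v) (assignmentAt w)
  edge⇒move {v} {w} e with 2≤ , next ← assignmentAt-edge e = v , w , e , 2≤ , next

  move⇒edge : ∀ {v w} → Move E (assignmentAt v) (assignmentAt w) → Edge E v w
  move⇒edge {v} {w} (a , b , eab , 2≤ , w≗) with refl ← pushedTo-active (pushedTo-assignmentAt v) eab 2≤ =
    subst (Edge E v) b≡w eab
    where
    b≡w : b ≡ w
    b≡w = pushedTo-injective (pushedTo-assignmentAt b) (pushedTo-assignmentAt w)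
            (λ u → trans (proj₂ (assignmentAt-edge eab) u) (sym (w≗ u)))

  reached : ∀ {A B} → (∃ λ v → PointwiseEq (assignmentAt v) A) → Reachable E A B →
            ∃ λ w → PointwiseEq (assignmentAt w) B
  reached found ε = found
  reached (v , v≗A) ((a , b , eab , 2≤ , B≗) ◅ rest)
    with refl ← pushedTo-active (pushedTo-assignmentAt v) eab (subst (2 ≤_) (sym (v≗A a)) 2≤) =
    reached (b , λ u → trans (proj₂ (assignmentAt-edge eab) u) (trans (moveAlong-cong v≗A a b u) (sym (B≗ u))))
            rest

  isoToAssignmentGraph : IsoToAssignmentGraph E S
  isoToAssignmentGraph =
    assignmentAt ,
    (λ v → proj₂ (proj₂ (pushedAssignment v))) ,
    (λ v w → pushedTo-injective (pushedTo-assignmentAt v) (pushedTo-assignmentAt w)) ,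
    (λ A → reached (r , pushedTo-unique (pushedTo-assignmentAt r) (inj₁ (refl , λ _ → refl)))) ,
    (λ v w → edge⇒move , move⇒edge)

module FromIsomorphism {n} {E : Graph n} (oriented : Oriented E) (S : Assignment n)
  (traversable : FullyTraversable E S) (iso : IsoToAssignmentGraph E S) where

  f : Fin n → Assignment n
  f = proj₁ iso

  f-reachable : ∀ v → Reachable E S (f v)
  f-reachable = proj₁ (proj₂ iso)

  f-injective : ∀ v w → PointwiseEq (f v) (f w) → v ≡ w
  f-injective = proj₁ (proj₂ (proj₂ iso))

  f-surjective : ∀ A → Reachable E S A → ∃ λ v → PointwiseEq (f v) A
  f-surjective = proj₁ (proj₂ (proj₂ (proj₂ iso)))

  edge⇒move : ∀ {x y} → Edge E x y → Move E (f x) (f y)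
  edge⇒move {x} {y} = proj₁ (proj₂ (proj₂ (proj₂ (proj₂ iso))) x y)

  move⇒edge : ∀ {x y} → Move E (f x) (f y) → Edge E x y
  move⇒edge {x} {y} = proj₂ (proj₂ (proj₂ (proj₂ (proj₂ iso))) x y)

  edge⇒≢ : ∀ {v w} → Edge E v w → v ≢ w
  edge⇒≢ {v} e refl = proj₁ oriented v e

  acyclic : Acyclic E
  acyclic exy y⋯x = Move⇒¬Reachable-back (proj₁ oriented) (edge⇒move exy) (gmap f edge⇒move y⋯x)

  extend : ∀ {A v w} → Reachable E S A → Edge E v w → 2 ≤ A v → Reachable E S (moveAlong A v w)
  extend reach e 2≤Av = reach ◅◅ moveAlong-Move e 2≤Av ◅ ε

  firedEdge : ∀ {A B} → Move E A B → Fin n × Fin n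
  firedEdge (v , w , _) = v , w

  relabelWith : ∀ x y b → E x y ≡ b → Fin n × Fin n
  relabelWith x y true  exy = firedEdge (edge⇒move exy)
  relabelWith x y false _   = x , y

  relabel : Fin n × Fin n → Fin n × Fin n
  relabel (x , y) = relabelWith x y (E x y) refl

  relabel-edge : ∀ {x y} → Edge E x y → ∃ λ (m : Move E (f x) (f y)) → relabel (x , y) ≡ firedEdge m
  relabel-edge {x} {y} = go (E x y) refl
    where
    go : ∀ b (p : E x y ≡ b) → b ≡ true → ∃ λ (m : Move E (f x) (f y)) → relabelWith x y b p ≡ firedEdge m
    go true p _ = edge⇒move p , refl

  relabel-nonEdge : ∀ {x y} → E x y ≡ false → relabel (x , y) ≡ (x , y)
  relabel-nonEdge {x} {y} = go (E x y) refl
    where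
    go : ∀ b (p : E x y ≡ b) → b ≡ false → relabelWith x y b p ≡ (x , y)
    go false p _ = refl

  relabel-fired : ∀ {x y v w} → Edge E v w → 2 ≤ f x v → PointwiseEq (f y) (moveAlong (f x) v w) →
                  relabel (x , y) ≡ (v , w)
  relabel-fired {x} evw 2≤ y≗
    with (a , b , eab , 2≤a , y≗ab) , relabelled ← relabel-edge (move⇒edge (_ , _ , evw , 2≤ , y≗))
    with refl , refl ← moveAlong-injective (f x) (edge⇒≢ eab) (edge⇒≢ evw) 2≤a (λ u → trans (sym (y≗ab u)) (y≗ u))
    = relabelled

  fire : ∀ {A v w} → Reachable E S A → Edge E v w → 2 ≤ A v →
         ∃₂ λ x y → PointwiseEq (f x) A × relabel (x , y) ≡ (v , w)
  fire {A} reach evw 2≤Av with x , x≗A ← f-surjective A reach | y , y≗B ← f-surjective _ (extend reach evw 2≤Av) =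
    x , y , x≗A , relabel-fired evw (subst (2 ≤_) (sym (x≗A _)) 2≤Av)
                                    (λ u → trans (y≗B u) (moveAlong-cong (λ u → sym (x≗A u)) _ _ u))

  relabel-surjective : ∀ p → ∃ λ q → relabel q ≡ p
  relabel-surjective (v , w) with E v w in evw
  ... | false = (v , w) , relabel-nonEdge evw
  ... | true with _ , reach , 2≤ ← proj₂ traversable v w evw
             with x , y , _ , fired ← fire reach evw 2≤ = (x , y) , fired

  relabel-injective : Injective _≡_ _≡_ relabel
  relabel-injective = surjective⇒injective (↔-sym *↔×) relabel relabel-surjective

  firing-determines : ∀ {A A′ v w} → Reachable E S A → Reachable E S A′ → Edge E v w → 2 ≤ A v → 2 ≤ A′ v →
                      PointwiseEq A A′
  firing-determines reach reach′ e 2≤ 2≤′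
    with x , y , x≗A , fired ← fire reach e 2≤ | x′ , y′ , x′≗A′ , fired′ ← fire reach′ e 2≤′
    with refl ← relabel-injective (trans fired (sym fired′)) = λ u → trans (sym (x≗A u)) (x′≗A′ u)

  active-unique : ∀ {A u u′ v v′} → Reachable E S A → Edge E u u′ → Edge E v v′ → 2 ≤ A u → 2 ≤ A v → u ≡ v
  active-unique {A} {u} {v = v} reach eu ev 2≤u 2≤v = decidable-stable (u ≟ v) λ u≢v →
    moveAlong-changes A 2≤u (firing-determines reach (extend reach eu 2≤u) ev 2≤v
                              (≤-trans 2≤v (moveAlong-≥ A (≢-sym u≢v))))

  active≤3 : ∀ {A v w} → Reachable E S A → Edge E v w → 2 ≤ A v → A v ≤ 3
  active≤3 {A} {v} {w} reach e 2≤Av = decidable-stable (A v ≤? 3) λ Av≰3 →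
    moveAlong-changes A 2≤Av (firing-determines reach (extend reach e 2≤Av) e 2≤Av
                               (subst (2 ≤_) (sym (moveAlong-source A v w)) (∸-monoˡ-≤ 2 (≰⇒> Av≰3))))

  firstFiring : ∀ {A v w} → Edge E v w → Reachable E S A → 2 ≤ A v → ∃₂ λ s t → Edge E s t × 2 ≤ S s
  firstFiring e ε                           2≤ = _ , _ , e , 2≤
  firstFiring _ ((s , t , est , 2≤s , _) ◅ _) _  = s , t , est , 2≤s

  initialFiring : ∃₂ λ s t → Edge E s t × 2 ≤ S s
  initialFiring = let v , w , e          = proj₁ traversable
                      _ , reach , 2≤Av   = proj₂ traversable v w e
                  in firstFiring e reach 2≤Av

  s₀ : Fin n
  s₀ = proj₁ initialFiring

  s₀-edge : Edge E s₀ (proj₁ (proj₂ initialFiring))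
  s₀-edge = proj₁ (proj₂ (proj₂ initialFiring))

  2≤s₀ : 2 ≤ S s₀
  2≤s₀ = proj₂ (proj₂ (proj₂ initialFiring))

  s₀≤3 : S s₀ ≤ 3
  s₀≤3 = active≤3 ε s₀-edge 2≤s₀

  initial-active : ∀ {u u′} → Edge E u u′ → 2 ≤ S u → u ≡ s₀
  initial-active e 2≤ = active-unique ε e s₀-edge 2≤ 2≤s₀

  -- The shape of an assignment reached by at least one move, ℓ being the target of the last one.
  record MovedTo (ℓ : Fin n) (A : Assignment n) : Set where
    field
      at-last        : A ℓ ≡ S ℓ + 1
      ≤-initial      : ∀ u → u ≢ ℓ → A u ≤ S u
      s₀-spent       : A s₀ + 2 ≤ S s₀
      lost⇒ancestor : ∀ u → A u < S u → Ancestor E u ℓ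
  open MovedTo

  Invariant : Assignment n → Set
  Invariant A = PointwiseEq A S ⊎ ∃ λ ℓ → MovedTo ℓ A

  s₀-lost : ∀ {ℓ A} → MovedTo ℓ A → A s₀ < S s₀
  s₀-lost {A = A} moved = <-≤-trans (m<m+n (A s₀) z<s) (s₀-spent moved)

  movedTo-active : ∀ {ℓ A u u′} → MovedTo ℓ A → Edge E u u′ → 2 ≤ A u → u ≡ ℓ
  movedTo-active {ℓ} {A} {u} moved e 2≤Au = decidable-stable (u ≟ ℓ) λ u≢ℓ →
    4≰3 (≤-trans (+-monoˡ-≤ 2 (2≤As₀ u≢ℓ)) (≤-trans (s₀-spent moved) s₀≤3))
    where
    4≰3 : ¬ 4 ≤ 3
    4≰3 (s≤s (s≤s (s≤s ())))

    2≤As₀ : u ≢ ℓ → 2 ≤ A s₀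
    2≤As₀ u≢ℓ = subst (λ z → 2 ≤ A z) (initial-active e (≤-trans 2≤Au (≤-initial moved u u≢ℓ))) 2≤Au

  movedTo-source : ∀ {ℓ A u u′} → MovedTo ℓ A → Edge E u u′ → 2 ≤ A u → MovedTo u A
  movedTo-source {A = A} moved e 2≤Au = subst (λ ℓ → MovedTo ℓ A) (sym (movedTo-active moved e 2≤Au)) moved

  first-move : ∀ {A B} → PointwiseEq A S → Move E A B → ∃ λ ℓ → MovedTo ℓ B
  first-move {A} {B} A≗S (v , w , e , 2≤Av , B≗) = w , record
    { at-last        = trans (B≗ w) (trans (moveAlong-target A v≢w) (cong (_+ 1) (A≗S w)))
    ; ≤-initial      = ≤-initial′
    ; s₀-spent       = subst (λ z → B z + 2 ≤ S z) (initial-active e 2≤Sv) spent-at-v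
    ; lost⇒ancestor = lost⇒ancestor′
    }
    where
    v≢w : v ≢ w
    v≢w = edge⇒≢ e

    2≤Sv : 2 ≤ S v
    2≤Sv = subst (2 ≤_) (A≗S v) 2≤Av

    spent-at-v : B v + 2 ≤ S v
    spent-at-v = ≤-reflexive (trans (cong (_+ 2) (trans (B≗ v) (trans (moveAlong-source A v w) (cong (_∸ 2) (A≗S v)))))
                                    (m∸n+n≡m 2≤Sv))

    ≤-initial′ : ∀ u → u ≢ w → B u ≤ S u
    ≤-initial′ u u≢w with v ≟ u
    ... | yes refl = subst (_≤ S v) (sym (trans (B≗ v) (moveAlong-source A v w)))
                           (subst (A v ∸ 2 ≤_) (A≗S v) (m∸n≤m (A v) 2))
    ... | no v≢u   = ≤-reflexive (trans (B≗ u) (trans (moveAlong-other A (≢-sym v≢u) u≢w) (A≗S u)))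

    lost⇒ancestor′ : ∀ u → B u < S u → Ancestor E u w
    lost⇒ancestor′ u Bu<Su with v ≟ u | w ≟ u
    ... | yes refl | _        = e ◅ ε
    ... | no _     | yes refl =
      ⊥-elim (m+n≮m (S w) 1 (subst (_< S w) (trans (B≗ w) (trans (moveAlong-target A v≢w) (cong (_+ 1) (A≗S w))))
                                   Bu<Su))
    ... | no v≢u   | no w≢u   =
      ⊥-elim (<-irrefl (trans (B≗ u) (trans (moveAlong-other A (≢-sym v≢u) (≢-sym w≢u)) (A≗S u))) Bu<Su)

  movedTo-fires : ∀ {ℓ A w} → MovedTo ℓ A → moveAlong A ℓ w ℓ ≡ S ℓ ∸ 1
  movedTo-fires {ℓ} {A} {w} moved = trans (moveAlong-source A ℓ w) (cong (_∸ 2) (trans (at-last moved) (+-comm (S ℓ) 1)))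

  next-move : ∀ {ℓ A B} → MovedTo ℓ A → Move E A B → ∃ λ ℓ′ → MovedTo ℓ′ B
  next-move {A = A} {B} moved (v , w , e , 2≤Av , B≗) = w , record
    { at-last        = Bw≡
    ; ≤-initial      = ≤-initial′
    ; s₀-spent       = subst (λ k → k + 2 ≤ S s₀) (sym (trans (B≗ s₀) (moveAlong-other A s₀≢v s₀≢w))) (s₀-spent movedᵥ)
    ; lost⇒ancestor = lost⇒ancestor′
    }
    where
    movedᵥ : MovedTo v A
    movedᵥ = movedTo-source moved e 2≤Av

    v≢w : v ≢ w
    v≢w = edge⇒≢ e

    Aw≡Sw : A w ≡ S w
    Aw≡Sw = ≤-antisym (≤-initial movedᵥ w (≢-sym v≢w))
                      (≮⇒≥ λ Aw<Sw → acyclic e (lost⇒ancestor movedᵥ w Aw<Sw))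

    Bw≡ : B w ≡ S w + 1
    Bw≡ = trans (B≗ w) (trans (moveAlong-target A v≢w) (cong (_+ 1) Aw≡Sw))

    s₀≢v : s₀ ≢ v
    s₀≢v refl =
      m+1+n≰m (S v) (subst (_≤ S v) (trans (cong (_+ 2) (at-last movedᵥ)) (+-assoc (S v) 1 2)) (s₀-spent movedᵥ))

    s₀≢w : s₀ ≢ w
    s₀≢w refl = m+1+n≰m (S w) (subst (λ k → k + 2 ≤ S w) Aw≡Sw (s₀-spent movedᵥ))

    ≤-initial′ : ∀ u → u ≢ w → B u ≤ S u
    ≤-initial′ u u≢w with v ≟ u
    ... | yes refl = subst (_≤ S v) (sym (trans (B≗ v) (movedTo-fires movedᵥ))) (m∸n≤m (S v) 1)
    ... | no v≢u   = subst (_≤ S u) (sym (trans (B≗ u) (moveAlong-other A (≢-sym v≢u) u≢w)))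
                           (≤-initial movedᵥ u (≢-sym v≢u))

    lost⇒ancestor′ : ∀ u → B u < S u → Ancestor E u w
    lost⇒ancestor′ u Bu<Su with w ≟ u | v ≟ u
    ... | yes refl | _        = ⊥-elim (m+n≮m (S w) 1 (subst (_< S w) Bw≡ Bu<Su))
    ... | no _     | yes refl = e ◅ ε
    ... | no w≢u   | no v≢u   =
      lost⇒ancestor movedᵥ u (subst (_< S u) (trans (B≗ u) (moveAlong-other A (≢-sym v≢u) (≢-sym w≢u))) Bu<Su)
      ◅◅ e ◅ ε

  invariant-step : ∀ {A B} → Invariant A → Move E A B → Invariant B
  invariant-step (inj₁ A≗S)         m = inj₂ (first-move A≗S m)
  invariant-step (inj₂ (_ , moved)) m = inj₂ (next-move moved m)

  invariant-preserved : ∀ {A B} → Invariant A → Reachable E A B → Invariant B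
  invariant-preserved inv ε          = inv
  invariant-preserved inv (m ◅ rest) = invariant-preserved (invariant-step inv m) rest

  invariant : ∀ {A} → Reachable E S A → Invariant A
  invariant = invariant-preserved (inj₁ λ _ → refl)

  common-successor⇒lost : ∀ {v A₁ A₂ v₁ w₁ w₂} → MovedTo v A₂ → v ≢ v₁ → 2 ≤ A₂ v →
                          PointwiseEq (moveAlong A₁ v₁ w₁) (moveAlong A₂ v w₂) → A₁ v < S v
  common-successor⇒lost {v} {A₁} moved v≢v₁ 2≤A₂v same =
    ≤-<-trans (≤-trans (moveAlong-≥ A₁ v≢v₁) (≤-reflexive (trans (same v) (movedTo-fires moved))))
              (∸-monoʳ-< z<s (2≤+1⇒1≤ (subst (2 ≤_) (at-last moved) 2≤A₂v)))

  common-successor⇒≗ : ∀ {A₁ A₂ B} → Reachable E S A₁ → Reachable E S A₂ → Move E A₁ B → Move E A₂ B →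
                       PointwiseEq A₁ A₂
  common-successor⇒≗ {A₁} {A₂} reach₁ reach₂ (v₁ , w₁ , e₁ , 2≤₁ , B≗₁) (v₂ , w₂ , e₂ , 2≤₂ , B≗₂)
    with v₁ ≟ v₂
  ... | yes refl = firing-determines reach₁ reach₂ e₁ 2≤₁ 2≤₂
  ... | no v₁≢v₂ = ⊥-elim (different-sources (invariant reach₁) (invariant reach₂))
    where
    same : PointwiseEq (moveAlong A₁ v₁ w₁) (moveAlong A₂ v₂ w₂)
    same u = trans (sym (B≗₁ u)) (B≗₂ u)

    lost₁ : MovedTo v₂ A₂ → A₁ v₂ < S v₂
    lost₁ moved₂ = common-successor⇒lost moved₂ (≢-sym v₁≢v₂) 2≤₂ same

    lost₂ : MovedTo v₁ A₁ → A₂ v₁ < S v₁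
    lost₂ moved₁ = common-successor⇒lost moved₁ v₁≢v₂ 2≤₁ (λ u → sym (same u))

    different-sources : Invariant A₁ → Invariant A₂ → ⊥
    different-sources (inj₁ A₁≗S) (inj₁ A₂≗S) =
      v₁≢v₂ (trans (initial-active e₁ (subst (2 ≤_) (A₁≗S v₁) 2≤₁))
                   (sym (initial-active e₂ (subst (2 ≤_) (A₂≗S v₂) 2≤₂))))
    different-sources (inj₁ A₁≗S) (inj₂ (_ , moved₂)) =
      <-irrefl (A₁≗S v₂) (lost₁ (movedTo-source moved₂ e₂ 2≤₂))
    different-sources (inj₂ (_ , moved₁)) (inj₁ A₂≗S) =
      <-irrefl (A₂≗S v₁) (lost₂ (movedTo-source moved₁ e₁ 2≤₁))
    different-sources (inj₂ (_ , moved₁)) (inj₂ (_ , moved₂)) =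
      v₁≢v₂ (acyclic⇒ancestor-antisym E acyclic (lost⇒ancestor movedᵥ₂ v₁ (lost₂ movedᵥ₁))
                                              (lost⇒ancestor movedᵥ₁ v₂ (lost₁ movedᵥ₂)))
      where
      movedᵥ₁ : MovedTo v₁ A₁
      movedᵥ₁ = movedTo-source moved₁ e₁ 2≤₁

      movedᵥ₂ : MovedTo v₂ A₂
      movedᵥ₂ = movedTo-source moved₂ e₂ 2≤₂

  inDegree≤1 : InDegree≤1 E
  inDegree≤1 {a} {b} eac ebc =
    f-injective a b (common-successor⇒≗ (f-reachable a) (f-reachable b) (edge⇒move eac) (edge⇒move ebc))

  root : Fin n
  root = proj₁ (f-surjective S ε)

  f-root : PointwiseEq (f root) S
  f-root = proj₂ (f-surjective S ε)

  trace : ∀ {x X Y} → PointwiseEq (f x) X → Reachable E S X → Reachable E X Y →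
          ∃ λ y → PointwiseEq (f y) Y × Ancestor E x y
  trace x≗X _ ε = _ , x≗X , ε
  trace x≗X reachX (m ◅ rest)
    with z , z≗Z ← f-surjective _ (reachX ◅◅ m ◅ ε)
    with y , y≗Y , z⋯y ← trace z≗Z (reachX ◅◅ m ◅ ε) rest
    = y , y≗Y , move⇒edge (Move-respʳ (Move-respˡ m (λ u → sym (x≗X u))) (λ u → sym (z≗Z u)))
              ◅ z⋯y

  rooted : Rooted E root
  rooted v with y , y≗ , root⋯y ← trace f-root ε (f-reachable v) =
    subst (Ancestor E root) (f-injective y v y≗) root⋯y

  root≡s₀ : root ≡ s₀
  root≡s₀ with unsnoc (rooted s₀)
  ... | inj₁ root≡s₀ = root≡s₀
  ... | inj₂ (p , _ , ep) with _ , reach , 2≤ ← proj₂ traversable p s₀ ep with invariant reach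
  ...   | inj₁ A≗S         = ⊥-elim (edge⇒≢ ep (initial-active ep (subst (2 ≤_) (A≗S p) 2≤)))
  ...   | inj₂ (_ , moved) =
    ⊥-elim (acyclic ep (lost⇒ancestor (movedTo-source moved ep 2≤) s₀ (s₀-lost moved)))

  inner-one : ∀ {v w} → v ≢ root → Edge E v w → S v ≡ 1
  inner-one {v} {w} v≢root e with _ , reach , 2≤ ← proj₂ traversable v w e with invariant reach
  ... | inj₁ A≗S         =
    ⊥-elim (v≢root (trans (initial-active e (subst (2 ≤_) (A≗S v) 2≤)) (sym root≡s₀)))
  ... | inj₂ (_ , moved) =
    ≤-antisym (decidable-stable (S v ≤? 1) λ Sv≰1 →
                 v≢root (trans (initial-active e (≰⇒> Sv≰1)) (sym root≡s₀)))
              (2≤+1⇒1≤ (subst (2 ≤_) (at-last (movedTo-source moved e 2≤)) 2≤))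

  downwardRootedTree : DownwardRootedTree E root
  downwardRootedTree =
    (rooted⇒connected E rooted , acyclic∧inDegree≤1⇒noUCycle E acyclic inDegree≤1) , rooted

  rootPebbling : RootPebbling E root S
  rootPebbling =
    subst (λ z → S z ≡ 2 ⊎ S z ≡ 3) (sym root≡s₀) (2≤∧≤3⇒2or3 2≤s₀ s₀≤3) ,
    λ v v≢root nonLeaf → decidable-stable (S v ℕ.≟ 1) λ Sv≢1 → nonLeaf λ w e → Sv≢1 (inner-one v≢root e)

mainTheorem1 : (n : ℕ) (E : Graph n) → Oriented E →
    (S : Assignment n) → FullyTraversable E S →
    (IsoToAssignmentGraph E S ⇔ Σ (Fin n) λ r → DownwardRootedTree E r × RootPebbling E r S)
mainTheorem1 n E oriented S traversable = mk⇔ tree⇐iso iso⇐tree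
  where
  tree⇐iso : IsoToAssignmentGraph E S → Σ (Fin n) λ r → DownwardRootedTree E r × RootPebbling E r S
  tree⇐iso iso = root , downwardRootedTree , rootPebbling
    where open FromIsomorphism oriented S traversable iso

  iso⇐tree : (Σ (Fin n) λ r → DownwardRootedTree E r × RootPebbling E r S) → IsoToAssignmentGraph E S
  iso⇐tree (r , ((_ , noCycle) , rooted) , root-pebbles , one-pebble) =
    FromTreePebbling.isoToAssignmentGraph S rooted (noUCycle⇒acyclic E oriented noCycle)
      (rooted∧noUCycle⇒inDegree≤1 E oriented noCycle rooted) root-pebbles one-pebble
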